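{- Let $B$ be any configuration of the restricted Container Relocation Problem, let $l \ge 0$, let $B^l$ be any node at level $l$ of the $A^*$ tree rooted at $B$, and let $B^{l+1}$ be any child of $B^l$ in that tree. Then $L_0(B^{l+1}) \ge L_0(B^l)$, where for a node $D$ at level $l'$ we write $L_0(D) = S_0(D) + l'$.
   Context: A bay has $C$ columns and $P$ tiers ($C \ge P \ge 3$); each column is a stack holding at most $P$ containers. Containers carry distinct integer labels giving their retrieval order; the containers present in a configuration have labels $n_1, n_1+1, \dots, N$. The target container is the smallest label present. A retrieval removes the target when it is topmost in its column. In the restricted CRP, a relocation is allowed only when the target is not topmost: the topmost container of the target's column is moved to the top of another column containing fewer than $P$ containers. A container is blocking if it lies (in the same column) above some container with a smaller label. $S_0(D)$ is the number of blocking containers in configuration $D$ (each counted once). The $A^*$ tree: for a configuration $D$, its reduction is obtained by repeatedly retrieving the target while it is topmost. The root (level $0$) is the reduction of $B$. If a node $D$ at level $l$ is nonempty, its children (at level $l+1$) are, for each column $c'$ different from the target's column and containing fewer than $P$ containers, the reduction of the configuration obtained from $D$ by relocating the topmost container of the target's column to column $c'$. Thus the level of a node is the number of relocations performed from the root. -}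

module Defs where

open import Data.Nat using (ℕ; zero; suc; _+_; _≤_; _<_; _<ᵇ_; _≡ᵇ_; _⊓_)
open import Data.Bool using (Bool; true; false; if_then_else_)
open import Data.List using (List; []; _∷_; length; concat; applyUpTo; map)
open import Data.Bool.ListAction using (any)
open import Data.Nat.ListAction using (sum)
open import Data.List.Relation.Unary.All using (All)
open import Data.List.Relation.Binary.Permutation.Propositional using (_↭_)
open import Data.Maybe using (Maybe; just; nothing)
open import Data.Vec using (Vec; toList; lookup; _[_]≔_)
open import Data.Fin using (Fin)
open import Data.Product using (∃; ∃-syntax; _×_)
open import Relation.Binary.PropositionalEquality using (_≡_; _≢_)
open import Data.List.Membership.Propositional using (_∈_)

-- A configuration of a bay with C columns: each column is a list of labels,
-- listed from TOP (head) to BOTTOM.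
Config : ℕ → Set
Config C = Vec (List ℕ) C

labels : ∀ {C} → Config C → List ℕ
labels B = concat (toList B)

size : ∀ {C} → Config C → ℕ
size B = length (labels B)

-- A valid configuration: every column holds at most P containers, and the
-- labels present are exactly (as a multiset, so pairwise distinct) n₁, n₁+1, …, n₁+k-1.
Valid : ∀ {C} → ℕ → Config C → Set
Valid {C} P B = All (λ col → length col ≤ P) (toList B)
              × ∃[ n₁ ] ∃[ k ] (labels B ↭ applyUpTo (n₁ +_) k)

minList : List ℕ → Maybe ℕ
minList [] = nothing
minList (x ∷ xs) with minList xs
... | nothing = just x
... | just m  = just (x ⊓ m)

target : ∀ {C} → Config C → Maybe ℕ
target B = minList (labels B)

removeTop : ∀ {C} → ℕ → Vec (List ℕ) C → Maybe (Vec (List ℕ) C)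
removeTop t Data.Vec.[] = nothing
removeTop t ((x ∷ xs) Data.Vec.∷ cs) with t ≡ᵇ x
... | true  = just (xs Data.Vec.∷ cs)
... | false with removeTop t cs
...   | nothing  = nothing
...   | just cs' = just ((x ∷ xs) Data.Vec.∷ cs')
removeTop t ([] Data.Vec.∷ cs) with removeTop t cs
... | nothing  = nothing
... | just cs' = just ([] Data.Vec.∷ cs')

retrieve : ∀ {C} → Config C → Maybe (Config C)
retrieve B with target B
... | nothing = nothing
... | just t  = removeTop t B

reduceFuel : ∀ {C} → ℕ → Config C → Config C
reduceFuel zero B = B
reduceFuel (suc n) B with retrieve B
... | nothing = B
... | just B' = reduceFuel n B'

-- reduction: retrieve the target repeatedly while it is topmost
-- (each retrieval removes a container, so `size B` steps suffice)
reduce : ∀ {C} → Config C → Config C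
reduce B = reduceFuel (size B) B

relocate : ∀ {C} → Config C → Fin C → Fin C → Config C
relocate B c c' with lookup B c
... | [] = B
... | x ∷ xs = ((B [ c ]≔ xs) [ c' ]≔ (x ∷ lookup B c'))

data Child {C : ℕ} (P : ℕ) (D : Config C) : Config C → Set where
  child : (t : ℕ) (c c' : Fin C) →
          target D ≡ just t →
          t ∈ lookup D c →
          c' ≢ c →
          length (lookup D c') < P →
          Child P D (reduce (relocate D c c'))

data InTree {C : ℕ} (P : ℕ) (B : Config C) : ℕ → Config C → Set where
  root : InTree P B 0 (reduce B)
  step : ∀ {l D D'} → InTree P B l D → Child P D D' → InTree P B (suc l) D'

blockingCol : List ℕ → ℕ
blockingCol [] = 0
blockingCol (x ∷ xs) = (if any (_<ᵇ x) xs then 1 else 0) + blockingCol xs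

S₀ : ∀ {C} → Config C → ℕ
S₀ B = sum (map blockingCol (toList B))

L₀ : ∀ {C} → Config C → ℕ → ℕ
L₀ D l = S₀ D + l

module Submission where

-- Retrieving the target never changes S₀: the target is the smallest label
-- present, so it blocks nothing, and taking a container off the top of a
-- column does not change which containers below it are blocking.  Hence a
-- child, which is the reduction of a single relocation, has S₀ of the
-- relocated configuration.  A relocation takes one container off the top of
-- a column, which lowers that column's count by at most one, and puts it on
-- top of another column, which cannot lower that column's count.  So S₀
-- drops by at most one while the level rises by exactly one.

open import Defs
open import Data.Nat using (ℕ; suc; _≤_; _≥_; _+_; _<ᵇ_; _≡ᵇ_)
open import Data.Nat.Properties
open import Algebra.Properties.CommutativeSemigroup +-commutativeSemigroup
  using (x∙yz≈y∙xz)
open import Data.Bool using (true; false; T)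
open import Data.Unit using (tt)
open import Data.List using (List; []; _∷_)
open import Data.Bool.ListAction using (any)
open import Data.List.Relation.Unary.All as All using (All; []; _∷_)
open import Data.List.Relation.Unary.All.Properties using (++⁻ˡ; ++⁻ʳ)
open import Data.Maybe using (just; nothing)
open import Data.Vec using (lookup; _[_]≔_)
open import Data.Fin using (Fin)
open import Data.Vec.Properties using (lookup∘update′)
open import Relation.Binary.PropositionalEquality
open import Data.Empty using (⊥-elim)

≡true⇒T : ∀ {b} → b ≡ true → T b
≡true⇒T refl = tt

minList-nothing⇒[] : ∀ xs → minList xs ≡ nothing → xs ≡ []
minList-nothing⇒[] [] _ = refl
minList-nothing⇒[] (x ∷ xs) eq with minList xs
minList-nothing⇒[] (x ∷ xs) () | nothing
minList-nothing⇒[] (x ∷ xs) () | just _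

minList-just⇒lowerBound : ∀ xs {m} → minList xs ≡ just m → All (m ≤_) xs
minList-just⇒lowerBound (x ∷ xs) eq with minList xs in e
minList-just⇒lowerBound (x ∷ xs) refl | nothing
  with refl ← minList-nothing⇒[] xs e = ≤-refl ∷ []
minList-just⇒lowerBound (x ∷ xs) refl | just m =
  m⊓n≤m x m ∷ All.map (≤-trans (m⊓n≤n x m)) (minList-just⇒lowerBound xs e)

any-<ᵇ-lowerBound : ∀ x xs → All (x ≤_) xs → any (_<ᵇ x) xs ≡ false
any-<ᵇ-lowerBound x [] [] = refl
any-<ᵇ-lowerBound x (y ∷ ys) (x≤y ∷ x≤ys) with y <ᵇ x in e
... | true  = ⊥-elim (<⇒≱ (<ᵇ⇒< y x (≡true⇒T e)) x≤y)
... | false = any-<ᵇ-lowerBound x ys x≤ys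

blockingCol-lowerBound-∷ : ∀ x xs → All (x ≤_) xs →
  blockingCol (x ∷ xs) ≡ blockingCol xs
blockingCol-lowerBound-∷ x xs x≤xs rewrite any-<ᵇ-lowerBound x xs x≤xs = refl

blockingCol-∷-≤ : ∀ x xs → blockingCol (x ∷ xs) ≤ 1 + blockingCol xs
blockingCol-∷-≤ x xs with any (_<ᵇ x) xs
... | true  = ≤-refl
... | false = n≤1+n _

blockingCol-∷-≥ : ∀ x xs → blockingCol xs ≤ blockingCol (x ∷ xs)
blockingCol-∷-≥ x xs = m≤n+m _ _

S₀-removeTop : ∀ {C} t (B : Config C) {B'} → All (t ≤_) (labels B) →
  removeTop t B ≡ just B' → S₀ B' ≡ S₀ B
S₀-removeTop t ((x ∷ xs) Data.Vec.∷ B) t≤B eq with t ≡ᵇ x in e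
... | true with refl ← eq with refl ← ≡ᵇ⇒≡ t x (≡true⇒T e) =
  cong (_+ S₀ B) (sym (blockingCol-lowerBound-∷ t xs (++⁻ʳ (t ∷ []) (++⁻ˡ (t ∷ xs) t≤B))))
... | false with removeTop t B in e′
...   | just _ with refl ← eq =
  cong (blockingCol (x ∷ xs) +_) (S₀-removeTop t B (++⁻ʳ (x ∷ xs) t≤B) e′)
S₀-removeTop t ([] Data.Vec.∷ B) t≤B eq with removeTop t B in e′
... | just _ with refl ← eq = S₀-removeTop t B t≤B e′

S₀-retrieve : ∀ {C} (B : Config C) {B'} → retrieve B ≡ just B' → S₀ B' ≡ S₀ B
S₀-retrieve B eq with target B in e
... | just t = S₀-removeTop t B (minList-just⇒lowerBound (labels B) e) eq

S₀-reduceFuel : ∀ {C} n (B : Config C) → S₀ (reduceFuel n B) ≡ S₀ B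
S₀-reduceFuel 0       B = refl
S₀-reduceFuel (suc n) B with retrieve B in e
... | nothing = refl
... | just B' = trans (S₀-reduceFuel n B') (S₀-retrieve B e)

S₀-reduce : ∀ {C} (B : Config C) → S₀ (reduce B) ≡ S₀ B
S₀-reduce B = S₀-reduceFuel (size B) B

S₀-[]≔-≤ : ∀ {C} (B : Config C) i k col →
  blockingCol (lookup B i) ≤ k + blockingCol col → S₀ B ≤ k + S₀ (B [ i ]≔ col)
S₀-[]≔-≤ (v Data.Vec.∷ B) Fin.zero k col v≤ = begin
  blockingCol v + S₀ B           ≤⟨ +-monoˡ-≤ (S₀ B) v≤ ⟩
  k + blockingCol col + S₀ B     ≡⟨ +-assoc k _ _ ⟩
  k + (blockingCol col + S₀ B)   ∎
  where open ≤-Reasoning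
S₀-[]≔-≤ (v Data.Vec.∷ B) (Fin.suc i) k col v≤ = begin
  blockingCol v + S₀ B                           ≤⟨ +-monoʳ-≤ (blockingCol v) (S₀-[]≔-≤ B i k col v≤) ⟩
  blockingCol v + (k + S₀ (B [ i ]≔ col))        ≡⟨ x∙yz≈y∙xz (blockingCol v) k _ ⟩
  k + (blockingCol v + S₀ (B [ i ]≔ col))        ∎
  where open ≤-Reasoning

S₀-pop : ∀ {C} (B : Config C) i {x xs} → lookup B i ≡ x ∷ xs →
  S₀ B ≤ 1 + S₀ (B [ i ]≔ xs)
S₀-pop B i {x} {xs} eq =
  S₀-[]≔-≤ B i 1 xs (subst (λ col → blockingCol col ≤ 1 + blockingCol xs) (sym eq) (blockingCol-∷-≤ x xs))

S₀-push : ∀ {C} (B : Config C) i x → S₀ B ≤ S₀ (B [ i ]≔ (x ∷ lookup B i))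
S₀-push B i x = S₀-[]≔-≤ B i 0 (x ∷ lookup B i) (blockingCol-∷-≥ x (lookup B i))

S₀-relocate : ∀ {C} (B : Config C) c c' → c' ≢ c → S₀ B ≤ 1 + S₀ (relocate B c c')
S₀-relocate B c c' c'≢c with lookup B c in e
... | []     = n≤1+n _
... | x ∷ xs = begin
  S₀ B                                              ≤⟨ S₀-pop B c e ⟩
  1 + S₀ B′                                         ≤⟨ +-monoʳ-≤ 1 (S₀-push B′ c' x) ⟩
  1 + S₀ (B′ [ c' ]≔ (x ∷ lookup B′ c'))            ≡⟨ cong (λ col → 1 + S₀ (B′ [ c' ]≔ (x ∷ col)))
                                                         (lookup∘update′ c'≢c B xs) ⟩
  1 + S₀ (B′ [ c' ]≔ (x ∷ lookup B c'))             ∎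
  where
    open ≤-Reasoning
    B′ = B [ c ]≔ xs

S₀-Child : ∀ {C} P {D D' : Config C} → Child P D D' → S₀ D ≤ 1 + S₀ D'
S₀-Child P {D} (child t c c' _ _ c'≢c _) =
  subst (λ s → S₀ D ≤ 1 + s) (sym (S₀-reduce (relocate D c c'))) (S₀-relocate D c c' c'≢c)

proposition1 : ∀ (C P : ℕ) → C ≥ P → P ≥ 3 →
    (B : Config C) → Valid P B →
    (l : ℕ) (Bl Bl+1 : Config C) →
    InTree P B l Bl → Child P Bl Bl+1 →
    L₀ Bl+1 (suc l) ≥ L₀ Bl l
proposition1 C P _ _ B _ l Bl Bl+1 _ isChild = begin
  S₀ Bl + l             ≤⟨ +-monoˡ-≤ l (S₀-Child P isChild) ⟩
  1 + S₀ Bl+1 + l       ≡⟨ sym (+-suc (S₀ Bl+1) l) ⟩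
  S₀ Bl+1 + suc l       ∎
  where open ≤-Reasoning
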